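{- Let $M=(a_{i,j})_{1\leq i,j\leq n}$ be a multi-symmetric matrix of size $n$. Then each column of the upper-triangular part of $M$ is a symmetric sequence, that is, $a_{i,j}=a_{j-i,j}$ for all $1\leq i<j\leq n$.
   Context: A square matrix $(a_{i,j})$ of size $n$ is doubly-symmetric if $a_{i,j}=a_{j,i}=a_{n-j+1,n-i+1}$ for all $1\leq i,j\leq n$. It is multi-symmetric if it is doubly-symmetric and each row of its upper-triangular part is a symmetric sequence, i.e. $a_{i,j}=a_{i,n-j+i+1}$ for all $1\leq i<j\leq n$. -}

module Defs where

open import Level using (Level)
open import Data.Nat using (ℕ; _+_; _∸_; _≤_; _<_)
open import Relation.Binary.PropositionalEquality using (_≡_)

-- A square matrix of size n with entries in A, indexed 1-based as in the paper:
-- M i j is the entry a_{i,j}; only indices 1 ≤ i, j ≤ n are meaningful, and all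
-- conditions below quantify only over such indices.
Matrix : ∀ {a} → Set a → Set a
Matrix A = ℕ → ℕ → A

DoublySymmetric : ∀ {a} {A : Set a} → ℕ → Matrix A → Set a
DoublySymmetric n M =
  ∀ i j → 1 ≤ i → i ≤ n → 1 ≤ j → j ≤ n →
    (M i j ≡ M j i) × (M j i ≡ M (n ∸ j + 1) (n ∸ i + 1))
  where open import Data.Product using (_×_)

MultiSymmetric : ∀ {a} {A : Set a} → ℕ → Matrix A → Set a
MultiSymmetric n M =
  DoublySymmetric n M ×
  (∀ i j → 1 ≤ i → i < j → j ≤ n → M i j ≡ M i (n ∸ j + i + 1))
  where open import Data.Product using (_×_)

-- Persymmetry carries a_{i,j} to a_{n-j+1,n-i+1}; the row symmetry of row n-j+1 moves
-- it to column n-j+i+1 of that row; and persymmetry again carries it to a_{j-i,j}.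
module Submission where

open import Defs
open import Data.List using ([]; _∷_)
open import Level using (Level)
open import Data.Nat using (ℕ; suc; _+_; _∸_; _≤_; _<_)
open import Data.Nat.Properties
open import Data.Nat.Tactic.RingSolver using (solve)
open import Data.Product using (_×_; _,_; proj₁; proj₂)
open import Relation.Binary.PropositionalEquality

private
  variable
    a : Level
    A : Set a
    n : ℕ
    M : Matrix A

reflected-index : ∀ {m i j} → 1 ≤ j → i + j ≡ suc m → i ≤ m × m ∸ i + 1 ≡ j
reflected-index {i = i} {j = suc j} _ eq with refl ← suc-injective (trans (sym (+-suc i j)) eq) =
  m≤m+n i j , trans (cong (_+ 1) (m+n∸m≡n i j)) (+-comm j 1)

persymmetric : DoublySymmetric n M → ∀ {i j i′ j′} →
  1 ≤ i → 1 ≤ j → 1 ≤ i′ → 1 ≤ j′ → i + j′ ≡ suc n → j + i′ ≡ suc n →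
  M i j ≡ M i′ j′
persymmetric {M = M} ds 1≤i 1≤j 1≤i′ 1≤j′ i+j′ j+i′
  with i≤n , n∸i+1≡j′ ← reflected-index 1≤j′ i+j′
     | j≤n , n∸j+1≡i′ ← reflected-index 1≤i′ j+i′ =
  trans (proj₁ sym-ij) (trans (proj₂ sym-ij) (cong₂ M n∸j+1≡i′ n∸i+1≡j′))
  where sym-ij = ds _ _ 1≤i i≤n 1≤j j≤n

row-palindrome : MultiSymmetric n M → ∀ {i j j′} →
  1 ≤ i → i < j → j ≤ n → j + j′ ≡ n + i + 1 → M i j ≡ M i j′
row-palindrome {n = n} {M = M} (_ , rs) {i} {j} {j′} 1≤i i<j j≤n j+j′ =
  trans (rs i j 1≤i i<j j≤n) (cong (M i) (+-cancelˡ-≡ j _ _ reflected))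
  where
  open ≡-Reasoning
  reflected : j + (n ∸ j + i + 1) ≡ j + j′
  reflected = begin
    j + (n ∸ j + i + 1)   ≡⟨ sym (+-assoc j (n ∸ j + i) 1) ⟩
    j + (n ∸ j + i) + 1   ≡⟨ cong (_+ 1) (sym (+-assoc j (n ∸ j) i)) ⟩
    j + (n ∸ j) + i + 1   ≡⟨ cong (λ x → x + i + 1) (m+[n∸m]≡n j≤n) ⟩
    n + i + 1             ≡⟨ sym j+j′ ⟩
    j + j′                ∎

-- With j = i + e and n = j + k, the chain passes through row r = k + 1 at the
-- columns c = e + k + 1 and c′ = k + i + 1, which are mirror images in that row.
column-palindrome : MultiSymmetric n M → ∀ i e k → 1 ≤ i → 1 ≤ e → i + e + k ≡ n →
  M i (i + e) ≡ M e (i + e)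
column-palindrome {M = M} ms@(ds , _) i e k 1≤i 1≤e refl =
  begin
    M i (i + e)                ≡⟨ persymmetric ds 1≤i 1≤i+e 1≤r 1≤c
                                    (solve (i ∷ e ∷ k ∷ []))
                                    (solve (i ∷ e ∷ k ∷ [])) ⟩
    M (k + 1) (e + k + 1)      ≡⟨ row-palindrome ms 1≤r r<c c≤n
                                    (solve (i ∷ e ∷ k ∷ [])) ⟩
    M (k + 1) (k + i + 1)      ≡⟨ persymmetric ds 1≤r 1≤c′ 1≤e 1≤i+e
                                    (solve (i ∷ e ∷ k ∷ []))
                                    (solve (i ∷ e ∷ k ∷ [])) ⟩
    M e (i + e)                ∎
  where
  open ≡-Reasoning
  1≤i+e : 1 ≤ i + e
  1≤i+e = ≤-trans 1≤i (m≤m+n i e)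
  1≤r : 1 ≤ k + 1
  1≤r = m≤n+m 1 k
  1≤c : 1 ≤ e + k + 1
  1≤c = m≤n+m 1 (e + k)
  1≤c′ : 1 ≤ k + i + 1
  1≤c′ = m≤n+m 1 (k + i)
  r<c : k + 1 < e + k + 1
  r<c = +-monoˡ-< 1 (subst (k <_) (+-comm k e) (m<m+n k 1≤e))
  c≤n : e + k + 1 ≤ i + e + k
  c≤n = subst₂ _≤_ (+-comm 1 (e + k)) (sym (+-assoc i e k)) (+-monoˡ-≤ (e + k) 1≤i)

proposition2 : ∀ {a} {A : Set a} (n : ℕ) (M : Matrix A) → MultiSymmetric n M →
    ∀ i j → 1 ≤ i → i < j → j ≤ n → M i j ≡ M (j ∸ i) j
proposition2 n M ms i j 1≤i i<j j≤n =
  subst (λ j → M i j ≡ M (j ∸ i) j) i+[j∸i]≡j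
    (trans (column-palindrome ms i (j ∸ i) (n ∸ j) 1≤i (m<n⇒0<n∸m i<j) i+[j∸i]+[n∸j]≡n)
           (cong (λ x → M x (i + (j ∸ i))) (sym (m+n∸m≡n i (j ∸ i)))))
  where
  i+[j∸i]≡j : i + (j ∸ i) ≡ j
  i+[j∸i]≡j = m+[n∸m]≡n (<⇒≤ i<j)
  i+[j∸i]+[n∸j]≡n : i + (j ∸ i) + (n ∸ j) ≡ n
  i+[j∸i]+[n∸j]≡n = trans (cong (_+ (n ∸ j)) i+[j∸i]≡j) (m+[n∸m]≡n j≤n)
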